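{- Let $\pi\in S_n$. Then $\mathrm{que}(\mathrm{psb}(\pi))=12\cdots n$ if and only if $\pi\in\mathrm{Av}(3421,53241,53214)$.
   Context: $\mathrm{Av}(T)$ is the set of permutations avoiding every pattern in $T$. The algorithm PSB processes $\pi=\pi_1\cdots\pi_n$ from left to right with one pop stack $S$ (initially empty; PUSH puts an element on top, POP removes all elements appending them to the output from top to bottom) and an initially empty output: for $i=1,\dots,n$, if $S$ is empty or $\pi_i=\mathrm{TOP}(S)-1$ (where $\mathrm{TOP}(S)$ is the top element of $S$), push $\pi_i$; else if $\pi_i<\mathrm{TOP}(S)-1$, append $\pi_i$ directly to the output (bypass); otherwise pop $S$ and then push $\pi_i$. After all entries are processed, pop $S$; the output is $\mathrm{psb}(\pi)$. Queuesort processes its input from left to right with a queue and a bypass: for the current entry $x$, if the queue is empty or $x$ is larger than the element at the back of the queue, $x$ is inserted at the back of the queue; otherwise, if $x$ is smaller than the front element of the queue, $x$ is output directly; otherwise the front element of the queue is output and $x$ is examined again. At the end the queue contents are output in order. Its output on $\tau$ is $\mathrm{que}(\tau)$. -}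

module Defs where

open import Data.Nat using (ℕ; zero; suc; _+_; _<_; _≤_; _<ᵇ_; _≡ᵇ_)
open import Data.Bool using (Bool; true; false; if_then_else_)
open import Data.List using (List; []; _∷_; _++_; length; reverse; lookup; upTo; map)
open import Data.List.Relation.Binary.Sublist.Propositional using (_⊆_)
open import Data.List.Relation.Binary.Permutation.Propositional using (_↭_)
open import Data.Fin using (Fin)
open import Data.Product using (Σ; ∃; _×_)
open import Data.Empty using (⊥)
open import Relation.Binary.PropositionalEquality using (_≡_)
open import Relation.Nullary using (¬_)
open import Function.Bundles using (_⇔_)

-- Permutations of [n] are lists of the values 1,…,n in one-line notation.
idPerm : ℕ → List ℕ
idPerm n = map suc (upTo n)

IsPerm : ℕ → List ℕ → Set
IsPerm n π = π ↭ idPerm n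

OrderIso : List ℕ → List ℕ → Set
OrderIso σ p = Σ (length σ ≡ length p) λ eq →
  ∀ (i j : Fin (length σ)) →
    (lookup σ i < lookup σ j) ⇔
    (lookup p (Data.Fin.cast eq i) < lookup p (Data.Fin.cast eq j))

Contains : List ℕ → List ℕ → Set
Contains π p = ∃ λ σ → (σ ⊆ π) × OrderIso σ p

data AllAvoid (π : List ℕ) : List (List ℕ) → Set where
  []  : AllAvoid π []
  _∷_ : ∀ {p T} → ¬ Contains π p → AllAvoid π T → AllAvoid π (p ∷ T)

Av : List (List ℕ) → List ℕ → Set
Av T π = AllAvoid π T

-- PSB: pop stack with bypass.
-- The stack is a list with the top element at the head.
-- psb-go stack input  returns the output produced from now on.

psb-go : List ℕ → List ℕ → List ℕ
psb-go S [] = S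
psb-go [] (x ∷ xs) = psb-go (x ∷ []) xs
psb-go (t ∷ S) (x ∷ xs) =
  if suc x ≡ᵇ t then psb-go (x ∷ t ∷ S) xs
  else if suc x <ᵇ t then x ∷ psb-go (t ∷ S) xs
  else (t ∷ S) ++ psb-go (x ∷ []) xs

psb : List ℕ → List ℕ
psb π = psb-go [] π

-- The queue is a list with the front at the head; `back` is its last element.
-- que-step Q x : process the current entry x against queue Q, returning
-- (output produced, new queue).

open import Data.Product using (_,_; proj₁; proj₂)

last : ℕ → List ℕ → ℕ
last x [] = x
last _ (y ∷ ys) = last y ys

que-step : List ℕ → ℕ → List ℕ × List ℕ
que-step [] x = [] , (x ∷ [])
que-step (f ∷ Q) x =
  if last f Q <ᵇ x then ([] , (f ∷ Q ++ (x ∷ [])))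
  else if x <ᵇ f then ((x ∷ []) , (f ∷ Q))
  else (let r = que-step Q x in (f ∷ proj₁ r) , proj₂ r)

que-go : List ℕ → List ℕ → List ℕ
que-go Q [] = Q
que-go Q (x ∷ xs) = let r = que-step Q x in proj₁ r ++ que-go (proj₂ r) xs

que : List ℕ → List ℕ
que τ = que-go [] τ

-- Queuesort with bypass keeps its queue increasing, and an entry x bypasses it only below
-- a queued entry c > x; so the output of a list of distinct entries is sorted unless some
-- v < x arrives later, i.e. unless c x v is a 321. Hence que (psb π) = 12⋯n iff psb π
-- avoids 321.
--
-- Along a run of PSB the stack holds consecutive values, every entry read while s is on
-- the stack is smaller than s, and everything read since the current top t was bypassed,
-- so lies below t - 1. Consequently an ascent of π stays an ascent of psb π, and a descent
-- c b of psb π is a descent of π in which c has left the stack before b is read: either a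
-- larger z popped it, and c z b a is a 3421, or c was bypassed under a top T. In the latter
-- case T - 1 is an entry of π, and wherever it sits relative to T, c, b and a it yields a
-- 3421, 53241 or 53214. Conversely, in each of these three patterns the entries playing
-- 3, 2, 1 have left the stack when the next of them is read, so they leave PSB in order.

module Submission where

open import Defs
open import Data.Nat using (ℕ; zero; suc; _<_; _≤_; _<ᵇ_; _≡ᵇ_; z≤n; s≤s; _≤?_)
open import Data.Nat.Properties
open import Data.Bool using (true; false; if_then_else_)
open import Data.Fin using (zero; suc; cast; #_)
open import Data.List using (List; []; _∷_; _++_; [_]; length; map; lookup)
open import Data.List.Properties using (++-assoc; ++-identityʳ; length-map; ∷-injectiveˡ; ∷-injectiveʳ)
open import Data.List.Membership.Propositional using (_∈_; _∉_)
open import Data.List.Membership.Propositional.Properties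
  using (∉[]; ∈-lookup; ∈-++⁺ˡ; ∈-++⁺ʳ; ∈-++⁻; ∈-map⁺; ∈-map⁻; ∈-upTo⁺; ∈-upTo⁻; ∈-∃++)
open import Data.List.Membership.DecPropositional _≟_ using (_∈?_)
open import Data.List.Relation.Unary.Any using (here; there)
open import Data.List.Relation.Unary.All as All using (All; []; _∷_)
open import Data.List.Relation.Unary.All.Properties using () renaming (++⁺ to All-++⁺)
open import Data.List.Relation.Unary.AllPairs as AllPairs using (AllPairs; []; _∷_)
import Data.List.Relation.Unary.AllPairs.Properties as AllPairs
open import Data.List.Relation.Unary.Linked using (Linked; []; [-]; _∷_)
open import Data.List.Relation.Unary.Linked.Properties using (Linked⇒AllPairs)
open import Data.List.Relation.Unary.Unique.Propositional using (Unique)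
open import Data.List.Relation.Unary.Sorted.TotalOrder using (Sorted)
open import Data.List.Relation.Unary.Sorted.TotalOrder.Properties using (AllPairs⇒Sorted; ↗↭↗⇒≋)
open import Data.List.Relation.Binary.Pointwise using (Pointwise-≡⇒≡)
open import Data.List.Relation.Binary.Sublist.Propositional
  using (_⊆_; []; _∷ʳ_; _∷_; ⊆-refl; ⊆-trans; minimum; from∈)
open import Data.List.Relation.Binary.Sublist.Propositional.Properties as Sublist
  using (Any-resp-⊆; All-resp-⊆)
open import Data.List.Relation.Binary.Permutation.Propositional
  using (_↭_; ↭-sym; ↭-trans; ↭-refl; ↭-reflexive; ↭-prep; ↭⇒↭ₛ; module PermutationReasoning)
open import Data.List.Relation.Binary.Permutation.Propositional.Properties as ↭
  using (∈-resp-↭; ∷↭∷ʳ)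
import Data.List.Relation.Binary.Permutation.Setoid.Properties as ↭ₛ
open import Data.Product using (∃; ∃₂; _×_; _,_; proj₁; proj₂)
open import Data.Sum using (_⊎_; inj₁; inj₂)
open import Data.Empty using (⊥; ⊥-elim)
open import Function using (_∘_)
open import Relation.Binary.PropositionalEquality
  using (_≡_; _≢_; refl; sym; trans; cong; subst; subst₂; setoid; module ≡-Reasoning)
open import Relation.Nullary using (¬_; yes; no)
open import Relation.Nullary.Reflects using (Reflects; ofʸ; ofⁿ; fromEquivalence)
open import Relation.Nullary.Decidable using (True; toWitness; _×-dec_)
open import Relation.Binary using (tri<; tri≈; tri>)
open import Function.Bundles using (_⇔_; mk⇔; Equivalence)
open import Function.Construct.Symmetry using (⇔-sym)
open import Function.Related.Propositional using (module EquationalReasoning)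
open import Function.Related.TypeIsomorphisms using (¬-cong-⇔)

private
  variable
    A : Set
    R : A → A → Set
    x y z : A
    xs ys zs : List A

-- Lists

AllPairs-resp-⊇ : xs ⊆ ys → AllPairs R ys → AllPairs R xs
AllPairs-resp-⊇ [] [] = []
AllPairs-resp-⊇ (_ ∷ʳ s) (_ ∷ r) = AllPairs-resp-⊇ s r
AllPairs-resp-⊇ (refl ∷ s) (a ∷ r) = All-resp-⊆ s a ∷ AllPairs-resp-⊇ s r

AllPairs-++-across : AllPairs R (xs ++ ys) → x ∈ xs → y ∈ ys → R x y
AllPairs-++-across {xs = _ ∷ xs} (a ∷ _) (here refl) q = All.lookup a (∈-++⁺ʳ xs q)
AllPairs-++-across {xs = _ ∷ xs} (_ ∷ r) (there p) q = AllPairs-++-across r p q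

AllPairs-++⁻ˡ : AllPairs R (xs ++ ys) → AllPairs R xs
AllPairs-++⁻ˡ {ys = ys} = AllPairs-resp-⊇ (Sublist.++⁺ʳ ys ⊆-refl)

AllPairs-++⁻ʳ : AllPairs R (xs ++ ys) → AllPairs R ys
AllPairs-++⁻ʳ {xs = xs} = AllPairs-resp-⊇ (Sublist.++⁺ˡ xs ⊆-refl)

Unique-resp-↭ : xs ↭ ys → Unique xs → Unique ys
Unique-resp-↭ p = ↭ₛ.Unique-resp-↭ (setoid _) (↭⇒↭ₛ p)

Unique-prefix : ∀ {π A : List ℕ} {xs} → π ≡ A ++ xs → Unique π → Unique A
Unique-prefix refl = AllPairs-++⁻ˡ

Unique-++-disjoint : Unique (xs ++ ys) → x ∈ xs → x ∉ ys
Unique-++-disjoint u p q = AllPairs-++-across u p q refl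

Unique-middle : Unique (xs ++ y ∷ ys) → y ∉ xs
Unique-middle u p = Unique-++-disjoint u p (here refl)

Unique-head : Unique (x ∷ xs) → x ∉ xs
Unique-head u = Unique-++-disjoint {xs = [ _ ]} u (here refl)

Increasing : List ℕ → Set
Increasing = AllPairs _<_

Increasing⇒Unique : Increasing xs → Unique xs
Increasing⇒Unique = AllPairs.map (λ p e → <-irrefl e p)

Increasing-↭⇒≡ : Increasing xs → Increasing ys → xs ↭ ys → xs ≡ ys
Increasing-↭⇒≡ xs↑ ys↑ p = Pointwise-≡⇒≡
  (↗↭↗⇒≋ ≤-totalOrder (sorted xs↑) (sorted ys↑) (↭⇒↭ₛ p))
  where
  sorted : ∀ {zs} → Increasing zs → Sorted ≤-totalOrder zs
  sorted = AllPairs⇒Sorted ≤-totalOrder ∘ AllPairs.map <⇒≤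

≡⇔Increasing : xs ↭ ys → Increasing ys → (xs ≡ ys) ⇔ Increasing xs
≡⇔Increasing xs↭ys ys↑ = mk⇔ (λ { refl → ys↑ }) (λ xs↑ → Increasing-↭⇒≡ xs↑ ys↑ xs↭ys)

∈-++-⊆ : x ∈ xs → ys ⊆ zs → x ∷ ys ⊆ xs ++ zs
∈-++-⊆ p s = Sublist.++⁺ (from∈ p) s

pair-⊆ : x ∈ xs → y ∈ ys → x ∷ y ∷ [] ⊆ xs ++ ys
pair-⊆ p q = ∈-++-⊆ p (from∈ q)

⊆-++-split : ∀ (ys : List A) {xs zs} → xs ⊆ ys ++ zs →
             ∃₂ λ xs₁ xs₂ → xs ≡ xs₁ ++ xs₂ × xs₁ ⊆ ys × xs₂ ⊆ zs
⊆-++-split [] s = [] , _ , refl , [] , s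
⊆-++-split (y ∷ ys) (.y ∷ʳ s) with ⊆-++-split ys s
... | xs₁ , xs₂ , refl , s₁ , s₂ = xs₁ , xs₂ , refl , y ∷ʳ s₁ , s₂
⊆-++-split (y ∷ ys) (refl ∷ s) with ⊆-++-split ys s
... | xs₁ , xs₂ , refl , s₁ , s₂ = y ∷ xs₁ , xs₂ , refl , refl ∷ s₁ , s₂

⊆-split-at : ∀ xs (y : A) ys {zs} → xs ++ y ∷ ys ⊆ zs →
             ∃₂ λ zs₁ zs₂ → zs ≡ zs₁ ++ y ∷ zs₂ × xs ⊆ zs₁ × ys ⊆ zs₂
⊆-split-at [] y ys (z ∷ʳ s) with ⊆-split-at [] y ys s
... | zs₁ , zs₂ , refl , _ , s₂ = z ∷ zs₁ , zs₂ , refl , minimum _ , s₂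
⊆-split-at [] y ys (refl ∷ s) = [] , _ , refl , [] , s
⊆-split-at (x ∷ xs) y ys (z ∷ʳ s) with ⊆-split-at (x ∷ xs) y ys s
... | zs₁ , zs₂ , refl , s₁ , s₂ = z ∷ zs₁ , zs₂ , refl , z ∷ʳ s₁ , s₂
⊆-split-at (x ∷ xs) y ys (refl ∷ s) with ⊆-split-at xs y ys s
... | zs₁ , zs₂ , refl , s₁ , s₂ = x ∷ zs₁ , zs₂ , refl , refl ∷ s₁ , s₂

⊆-∷ʳ-split : ∀ xs → x ∷ y ∷ [] ⊆ xs ++ [ z ] → x ∷ y ∷ [] ⊆ xs ⊎ (y ≡ z × x ∈ xs)
⊆-∷ʳ-split [] (_ ∷ʳ ())
⊆-∷ʳ-split [] (refl ∷ ())
⊆-∷ʳ-split (w ∷ xs) (.w ∷ʳ s) with ⊆-∷ʳ-split xs s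
... | inj₁ s′ = inj₁ (w ∷ʳ s′)
... | inj₂ (e , m) = inj₂ (e , there m)
⊆-∷ʳ-split (w ∷ xs) (refl ∷ s) with ∈-++⁻ xs (Any-resp-⊆ s (here refl))
... | inj₁ m = inj₁ (refl ∷ from∈ m)
... | inj₂ (here refl) = inj₂ (refl , here refl)

precedes-prefix : ∀ xs {ys} → Unique (xs ++ y ∷ ys) → x ∷ y ∷ [] ⊆ xs ++ y ∷ ys → x ∈ xs
precedes-prefix [] u (_ ∷ʳ s) = ⊥-elim (Unique-head u (Any-resp-⊆ s (there (here refl))))
precedes-prefix [] u (refl ∷ s) = ⊥-elim (Unique-head u (Any-resp-⊆ s (here refl)))
precedes-prefix (w ∷ xs) (_ ∷ u) (.w ∷ʳ s) = there (precedes-prefix xs u s)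
precedes-prefix (w ∷ xs) _ (refl ∷ s) = here refl

follows-suffix : ∀ xs {ys} → Unique (xs ++ x ∷ ys) → x ∷ y ∷ [] ⊆ xs ++ x ∷ ys → y ∈ ys
follows-suffix [] u (_ ∷ʳ s) = ⊥-elim (Unique-head u (Any-resp-⊆ s (here refl)))
follows-suffix [] u (refl ∷ s) = Any-resp-⊆ s (here refl)
follows-suffix (w ∷ xs) (_ ∷ u) (.w ∷ʳ s) = follows-suffix xs u s
follows-suffix (w ∷ xs) u (refl ∷ s) = ⊥-elim (Unique-head u (∈-++⁺ʳ xs (here refl)))

module _ {τ : List A} (τ! : Unique τ) where

  precedes-asym : x ∷ y ∷ [] ⊆ τ → y ∷ x ∷ [] ⊆ τ → ⊥
  precedes-asym xy yx with ∈-∃++ (Any-resp-⊆ xy (there (here refl)))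
  ... | xs , ys , refl =
    Unique-++-disjoint τ! (precedes-prefix xs τ! xy) (there (follows-suffix xs τ! yx))

  precedes-trans : x ∷ y ∷ [] ⊆ τ → y ∷ z ∷ [] ⊆ τ → x ∷ y ∷ z ∷ [] ⊆ τ
  precedes-trans xy yz with ∈-∃++ (Any-resp-⊆ xy (there (here refl)))
  ... | xs , ys , refl = ∈-++-⊆ (precedes-prefix xs τ! xy) (refl ∷ from∈ (follows-suffix xs τ! yz))

module _ (go : List ℕ → List ℕ → List ℕ) (step : List ℕ → ℕ → List ℕ × List ℕ)
         (go-[] : ∀ S → go S [] ≡ S)
         (go-∷ : ∀ S x xs → go S (x ∷ xs) ≡ proj₁ (step S x) ++ go (proj₂ (step S x)) xs)
         (step-conserves : ∀ S x → proj₁ (step S x) ++ proj₂ (step S x) ↭ S ++ [ x ])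
         where

  run-↭ : ∀ S xs → go S xs ↭ S ++ xs
  run-↭ S [] = ↭-reflexive (trans (go-[] S) (sym (++-identityʳ S)))
  run-↭ S (x ∷ xs) = begin
    go S (x ∷ xs)                          ≡⟨ go-∷ S x xs ⟩
    out ++ go S′ xs                        ↭⟨ ↭.++⁺ˡ out (run-↭ S′ xs) ⟩
    out ++ S′ ++ xs                        ≡⟨ ++-assoc out S′ xs ⟨
    (out ++ S′) ++ xs                      ↭⟨ ↭.++⁺ʳ xs (step-conserves S x) ⟩
    (S ++ [ x ]) ++ xs                     ≡⟨ ++-assoc S [ x ] xs ⟩
    S ++ x ∷ xs                            ∎
    where
    open PermutationReasoning
    out S′ : List ℕ
    out = proj₁ (step S x)
    S′ = proj₂ (step S x)

≮∧≢⇒> : ∀ {m n} → ¬ m < n → m ≢ n → n < m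
≮∧≢⇒> m≮n m≢n = ≤∧≢⇒< (≮⇒≥ m≮n) (m≢n ∘ sym)

Increasing-++ : Increasing xs → Increasing ys → (∀ {u v} → u ∈ xs → v ∈ ys → u < v) →
                Increasing (xs ++ ys)
Increasing-++ xs↑ ys↑ xs<ys =
  AllPairs.++⁺ xs↑ ys↑ (All.tabulate λ p → All.tabulate λ q → xs<ys p q)

Increasing-∷ʳ : Increasing xs → All (_< x) xs → Increasing (xs ++ [ x ])
Increasing-∷ʳ xs↑ xs<x = Increasing-++ xs↑ ([] ∷ []) λ { p (here refl) → All.lookup xs<x p }

-- Queuesort

que-step-↭ : ∀ Q x → proj₁ (que-step Q x) ++ proj₂ (que-step Q x) ↭ Q ++ [ x ]
que-step-↭ [] x = ↭-refl
que-step-↭ (f ∷ Q) x with last f Q <ᵇ x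
... | true = ↭-refl
... | false with x <ᵇ f
... | true = ∷↭∷ʳ x (f ∷ Q)
... | false = ↭-prep f (que-step-↭ Q x)

que-go-↭ : ∀ Q xs → que-go Q xs ↭ Q ++ xs
que-go-↭ = run-↭ que-go que-step (λ _ → refl) (λ _ _ _ → refl) que-step-↭

last∈ : ∀ (f : ℕ) Q → last f Q ∈ f ∷ Q
last∈ f [] = here refl
last∈ f (g ∷ Q) = there (last∈ g Q)

below-last : ∀ {f Q} → Increasing (f ∷ Q) → last f Q < x → All (_< x) (f ∷ Q)
below-last {Q = []} _ back<x = back<x ∷ []
below-last {Q = g ∷ Q} (f<gQ ∷ gQ↑) back<x with below-last gQ↑ back<x
... | g<x ∷ Q<x = <-trans (All.lookup f<gQ (here refl)) g<x ∷ g<x ∷ Q<x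

data QueueStep (Q : List ℕ) (x : ℕ) : List ℕ × List ℕ → Set where
  enqueue : All (_< x) Q → QueueStep Q x ([] , Q ++ [ x ])
  flush   : ∀ L Q′ {c} → Q ≡ L ++ Q′ → All (_< x) L → All (x <_) Q′ → c ∈ Q′ →
            QueueStep Q x (L ++ [ x ] , Q′)

que-step-view : ∀ Q x → Increasing Q → x ∉ Q → QueueStep Q x (que-step Q x)
que-step-view [] x _ _ = enqueue []
que-step-view (f ∷ Q) x Q↑ x∉ with last f Q <ᵇ x | <ᵇ-reflects-< (last f Q) x
... | true | ofʸ back<x = enqueue (below-last Q↑ back<x)
... | false | ofⁿ back≮x with x <ᵇ f | <ᵇ-reflects-< x f
... | true | ofʸ x<f = flush [] (f ∷ Q) refl [] (x<f ∷ All.map (<-trans x<f) (AllPairs.head Q↑)) (here refl)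
... | false | ofⁿ x≮f with que-step Q x | que-step-view Q x (AllPairs.tail Q↑) (x∉ ∘ there)
... | _ | enqueue Q<x = ⊥-elim (back≮x (All.lookup (f<x ∷ Q<x) (last∈ f Q)))
  where
  f<x : f < x
  f<x = ≮∧≢⇒> x≮f (x∉ ∘ here)
... | _ | flush L Q′ refl L<x x<Q′ c∈Q′ = flush (f ∷ L) Q′ refl (f<x ∷ L<x) x<Q′ c∈Q′
  where
  f<x : f < x
  f<x = ≮∧≢⇒> x≮f (x∉ ∘ here)

data Has321 (τ : List ℕ) : Set where
  has321 : ∀ {c b a} → c ∷ b ∷ a ∷ [] ⊆ τ → b < c → a < b → Has321 τ

Has321-resp-⊆ : xs ⊆ ys → Has321 xs → Has321 ys
Has321-resp-⊆ s (has321 s′ b<c a<b) = has321 (⊆-trans s′ s) b<c a<b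

Increasing⇒precedes⇒< : Increasing xs → x ∷ y ∷ [] ⊆ xs → x < y
Increasing⇒precedes⇒< (_ ∷ xs↑) (_ ∷ʳ s) = Increasing⇒precedes⇒< xs↑ s
Increasing⇒precedes⇒< (x<xs ∷ _) (refl ∷ s) = All.lookup x<xs (Any-resp-⊆ s (here refl))

Increasing⇒¬Has321 : Increasing xs → ¬ Has321 xs
Increasing⇒¬Has321 xs↑ (has321 s b<c _) =
  <-asym b<c (Increasing⇒precedes⇒< xs↑ (⊆-trans (refl ∷ refl ∷ minimum _) s))

after-flush-⊆ : ∀ L Q′ (x : ℕ) xs → Q′ ++ xs ⊆ (L ++ Q′) ++ x ∷ xs
after-flush-⊆ L Q′ x xs = subst (Q′ ++ xs ⊆_) (sym (++-assoc L Q′ (x ∷ xs)))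
  (Sublist.++⁺ˡ L (Sublist.++⁺ ⊆-refl (x ∷ʳ ⊆-refl)))

que-go-increasing : ∀ Q xs → Increasing Q → Unique (Q ++ xs) → ¬ Has321 (Q ++ xs) →
                    Increasing (que-go Q xs)
que-go-increasing Q [] Q↑ _ _ = Q↑
que-go-increasing Q (x ∷ xs) Q↑ u no321 with que-step Q x | que-step-view Q x Q↑ (Unique-middle u)
... | _ | enqueue Q<x =
  que-go-increasing (Q ++ [ x ]) xs (Increasing-∷ʳ Q↑ Q<x)
    (subst Unique (sym (++-assoc Q [ x ] xs)) u) (no321 ∘ subst Has321 (++-assoc Q [ x ] xs))
... | _ | flush L Q′ {c} refl L<x x<Q′ c∈Q′ =
  Increasing-++ (Increasing-∷ʳ (AllPairs-resp-⊇ (Sublist.++⁺ʳ Q′ ⊆-refl) Q↑) L<x) rest↑ Lx<rest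
  where
  rest⊆ : Q′ ++ xs ⊆ (L ++ Q′) ++ x ∷ xs
  rest⊆ = after-flush-⊆ L Q′ x xs
  rest↑ : Increasing (que-go Q′ xs)
  rest↑ = que-go-increasing Q′ xs (AllPairs-++⁻ʳ Q↑) (AllPairs-resp-⊇ rest⊆ u)
            (no321 ∘ Has321-resp-⊆ rest⊆)
  x<rest : ∀ {v} → v ∈ que-go Q′ xs → x < v
  x<rest {v} p with ∈-++⁻ Q′ (∈-resp-↭ (que-go-↭ Q′ xs) p)
  ... | inj₁ v∈Q′ = All.lookup x<Q′ v∈Q′
  ... | inj₂ v∈xs with <-cmp x v
  ...   | tri< x<v _ _ = x<v
  ...   | tri≈ _ refl _ = ⊥-elim (Unique-head (AllPairs-++⁻ʳ {xs = L ++ Q′} u) v∈xs)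
  ...   | tri> _ _ v<x = ⊥-elim (no321 (has321 (∈-++-⊆ (∈-++⁺ʳ L c∈Q′) (refl ∷ from∈ v∈xs))
                                               (All.lookup x<Q′ c∈Q′) v<x))
  Lx<rest : ∀ {u v} → u ∈ L ++ [ x ] → v ∈ que-go Q′ xs → u < v
  Lx<rest p q with ∈-++⁻ L p
  ... | inj₁ u∈L = <-trans (All.lookup L<x u∈L) (x<rest q)
  ... | inj₂ (here refl) = x<rest q

que-go-increasing⇒¬Has321 : ∀ Q xs → Increasing Q → Unique (Q ++ xs) →
                             Increasing (que-go Q xs) → ¬ Has321 (Q ++ xs)
que-go-increasing⇒¬Has321 Q [] Q↑ _ _ = Increasing⇒¬Has321 Q↑ ∘ subst Has321 (++-identityʳ Q)
que-go-increasing⇒¬Has321 Q (x ∷ xs) Q↑ u out↑ with que-step Q x | que-step-view Q x Q↑ (Unique-middle u)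
... | _ | enqueue Q<x =
  que-go-increasing⇒¬Has321 (Q ++ [ x ]) xs (Increasing-∷ʳ Q↑ Q<x)
    (subst Unique (sym (++-assoc Q [ x ] xs)) u) out↑ ∘ subst Has321 (sym (++-assoc Q [ x ] xs))
... | _ | flush L Q′ refl L<x _ _ = no321
  where
  rest⊆ : Q′ ++ xs ⊆ (L ++ Q′) ++ x ∷ xs
  rest⊆ = after-flush-⊆ L Q′ x xs
  x<rest : ∀ {v} → v ∈ Q′ ++ xs → x < v
  x<rest p = AllPairs-++-across {xs = L ++ [ x ]} out↑ (∈-++⁺ʳ L (here refl))
               (∈-resp-↭ (↭-sym (que-go-↭ Q′ xs)) p)
  x<xs : ∀ {v} → x ∷ v ∷ [] ⊆ x ∷ xs → x < v
  x<xs (_ ∷ʳ s) = ⊥-elim (Unique-head (AllPairs-++⁻ʳ {xs = L ++ Q′} u) (Any-resp-⊆ s (here refl)))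
  x<xs (refl ∷ s) = x<rest (∈-++⁺ʳ Q′ (Any-resp-⊆ s (here refl)))
  rest¬321 : ¬ Has321 (Q′ ++ xs)
  rest¬321 = que-go-increasing⇒¬Has321 Q′ xs (AllPairs-++⁻ʳ Q↑) (AllPairs-resp-⊇ rest⊆ u)
               (AllPairs-++⁻ʳ {xs = L ++ [ x ]} out↑)
  no321 : ¬ Has321 ((L ++ Q′) ++ x ∷ xs)
  no321 (has321 {c} {b} {a} s b<c a<b) with ⊆-++-split (L ++ Q′) s
  ... | [] , _ , refl , _ , (_ ∷ʳ s₂) = rest¬321 (has321 (Sublist.++⁺ˡ Q′ s₂) b<c a<b)
  ... | [] , _ , refl , _ , (refl ∷ s₂) = <-asym b<c (x<xs (refl ∷ ⊆-trans (refl ∷ minimum _) s₂))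
  ... | _ ∷ [] , _ , refl , _ , (refl ∷ s₂) = <-asym a<b (x<xs (refl ∷ s₂))
  ... | _ ∷ [] , _ , refl , s₁ , (_ ∷ʳ s₂) with ∈-++⁻ L (Any-resp-⊆ s₁ (here refl))
  ...   | inj₁ c∈L = <-asym b<c (<-trans (All.lookup L<x c∈L) (x<rest (∈-++⁺ʳ Q′ (Any-resp-⊆ s₂ (here refl)))))
  ...   | inj₂ c∈Q′ = rest¬321 (has321 (∈-++-⊆ c∈Q′ s₂) b<c a<b)
  no321 (has321 s b<c a<b) | _ ∷ _ ∷ _ , _ , e , s₁ , _
    with refl ← ∷-injectiveˡ e | refl ← ∷-injectiveˡ (∷-injectiveʳ e) =
    <-asym b<c (Increasing⇒precedes⇒< Q↑ (⊆-trans (refl ∷ refl ∷ minimum _) s₁))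

que-sorts⇔¬321 : ∀ {τ} → Unique τ → Increasing (que τ) ⇔ (¬ Has321 τ)
que-sorts⇔¬321 {τ} τ! = mk⇔ (que-go-increasing⇒¬Has321 [] τ [] τ!) (que-go-increasing [] τ [] τ!)

-- Pop stack with bypass

psb-step : List ℕ → ℕ → List ℕ × List ℕ
psb-step [] x = [] , x ∷ []
psb-step (t ∷ S) x =
  if suc x ≡ᵇ t then ([] , x ∷ t ∷ S)
  else if suc x <ᵇ t then (x ∷ [] , t ∷ S)
  else (t ∷ S , x ∷ [])

psb-go-∷ : ∀ S x xs → psb-go S (x ∷ xs) ≡ proj₁ (psb-step S x) ++ psb-go (proj₂ (psb-step S x)) xs
psb-go-∷ [] x xs = refl
psb-go-∷ (t ∷ S) x xs with suc x ≡ᵇ t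
... | true = refl
... | false with suc x <ᵇ t
... | true = refl
... | false = refl

data PsbStep : List ℕ → ℕ → List ℕ × List ℕ → Set where
  start  : PsbStep [] x ([] , x ∷ [])
  push   : ∀ {t S} → suc x ≡ t → PsbStep (t ∷ S) x ([] , x ∷ t ∷ S)
  bypass : ∀ {t S} → suc x < t → PsbStep (t ∷ S) x (x ∷ [] , t ∷ S)
  pop    : ∀ {t S} → t ≤ x → PsbStep (t ∷ S) x (t ∷ S , x ∷ [])

≡ᵇ-reflects-≡ : ∀ m n → Reflects (m ≡ n) (m ≡ᵇ n)
≡ᵇ-reflects-≡ m n = fromEquivalence (≡ᵇ⇒≡ m n) (≡⇒≡ᵇ m n)

psb-step-view : ∀ S x → PsbStep S x (psb-step S x)
psb-step-view [] x = start
psb-step-view (t ∷ S) x with suc x ≡ᵇ t | ≡ᵇ-reflects-≡ (suc x) t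
... | true | ofʸ x+1≡t = push x+1≡t
... | false | ofⁿ x+1≢t with suc x <ᵇ t | <ᵇ-reflects-< (suc x) t
... | true | ofʸ x+1<t = bypass x+1<t
... | false | ofⁿ x+1≮t = pop (≤-pred (≮∧≢⇒> x+1≮t x+1≢t))

psb-step-↭ : ∀ S x → proj₁ (psb-step S x) ++ proj₂ (psb-step S x) ↭ S ++ [ x ]
psb-step-↭ S x with psb-step S x | psb-step-view S x
... | _ | start = ↭-refl
... | _ | push {t = t} {S = S′} _ = ∷↭∷ʳ x (t ∷ S′)
... | _ | bypass {t = t} {S = S′} _ = ∷↭∷ʳ x (t ∷ S′)
... | _ | pop _ = ↭-refl

psb-go-↭ : ∀ S xs → psb-go S xs ↭ S ++ xs
psb-go-↭ = run-↭ psb-go psb-step (λ _ → refl) psb-go-∷ psb-step-↭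

stack⊆psb-go : ∀ S xs → S ⊆ psb-go S xs
stack⊆psb-go S [] = ⊆-refl
stack⊆psb-go S (x ∷ xs) rewrite psb-go-∷ S x xs with psb-step S x | psb-step-view S x
... | _ | start = minimum _
... | _ | push _ = ⊆-trans (x ∷ʳ ⊆-refl) (stack⊆psb-go (x ∷ S) xs)
... | _ | bypass _ = x ∷ʳ stack⊆psb-go S xs
... | _ | pop _ = Sublist.++⁺ʳ _ ⊆-refl

stackAfter : List ℕ → List ℕ → List ℕ
stackAfter S [] = S
stackAfter S (x ∷ xs) = stackAfter (proj₂ (psb-step S x)) xs

emitted : List ℕ → List ℕ → List ℕ
emitted S [] = []
emitted S (x ∷ xs) = proj₁ (psb-step S x) ++ emitted (proj₂ (psb-step S x)) xs

psb-go-++ : ∀ S xs ys → psb-go S (xs ++ ys) ≡ emitted S xs ++ psb-go (stackAfter S xs) ys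
psb-go-++ S [] ys = refl
psb-go-++ S (x ∷ xs) ys = begin
  psb-go S (x ∷ xs ++ ys)                             ≡⟨ psb-go-∷ S x (xs ++ ys) ⟩
  out ++ psb-go S′ (xs ++ ys)                         ≡⟨ cong (out ++_) (psb-go-++ S′ xs ys) ⟩
  out ++ emitted S′ xs ++ psb-go (stackAfter S′ xs) ys ≡⟨ ++-assoc out _ _ ⟨
  emitted S (x ∷ xs) ++ psb-go (stackAfter S′ xs) ys   ∎
  where
  open ≡-Reasoning
  out S′ : List ℕ
  out = proj₁ (psb-step S x)
  S′ = proj₂ (psb-step S x)

stackAfter-++ : ∀ S xs ys → stackAfter S (xs ++ ys) ≡ stackAfter (stackAfter S xs) ys
stackAfter-++ S [] ys = refl
stackAfter-++ S (x ∷ xs) ys = stackAfter-++ _ xs ys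

stack : List ℕ → List ℕ
stack = stackAfter []

read-emitted-or-stacked : ∀ {A u} → u ∈ A → u ∈ emitted [] A ⊎ u ∈ stack A
read-emitted-or-stacked {A} p =
  ∈-++⁻ (emitted [] A) (∈-resp-↭ (↭-sym (↭-trans split (psb-go-↭ [] A))) p)
  where
  split : emitted [] A ++ stack A ↭ psb-go [] A
  split = ↭-reflexive (sym (trans (cong (psb-go []) (sym (++-identityʳ A))) (psb-go-++ [] A [])))

Consecutive : List ℕ → Set
Consecutive = Linked (λ a b → suc a ≡ b)

top≤stack : ∀ {t S s} → Consecutive (t ∷ S) → s ∈ t ∷ S → t ≤ s
top≤stack _ (here refl) = ≤-refl
top≤stack (refl ∷ c) (there p) = ≤-trans (n≤1+n _) (top≤stack c p)

consecutive-interval : ∀ {t S s v} → Consecutive (t ∷ S) → s ∈ t ∷ S → t ≤ v → v ≤ s → v ∈ t ∷ S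
consecutive-interval c p t≤v v≤s with m≤n⇒m<n∨m≡n t≤v
... | inj₂ refl = here refl
... | inj₁ t<v with c | p
...   | _ | here refl = ⊥-elim (<-irrefl refl (<-≤-trans t<v v≤s))
...   | [-] | there ()
...   | refl ∷ c′ | there p′ = there (consecutive-interval c′ p′ t<v v≤s)

-- Facts about the stack S (top first) of PSB after it has read P. The last field says that
-- everything read since the current top t was bypassed.
record StackInvariant (P S : List ℕ) : Set where
  field
    stack⊆read   : ∀ {s} → s ∈ S → s ∈ P
    consecutive  : Consecutive S
    read≤stack   : ∀ {y} → y ∈ P → ∃ λ s → s ∈ S × y ≤ s
    later<stack  : ∀ {s y} → s ∈ S → s ∷ y ∷ [] ⊆ P → y < s
    bypassed<top : ∀ {t S′} → S ≡ t ∷ S′ →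
                   ∃₂ λ P₁ M → P ≡ P₁ ++ t ∷ M × All (λ m → suc m < t) M
open StackInvariant

stack-interval : ∀ {P S s v y} → StackInvariant P S → s ∈ S → s ≤ v → y ∈ P → v ≤ y → v ∈ S
stack-interval {S = t ∷ _} I s∈S s≤v y∈P v≤y with read≤stack I y∈P
... | s′ , s′∈S , y≤s′ =
  consecutive-interval (consecutive I) s′∈S (≤-trans (top≤stack (consecutive I) s∈S) s≤v) (≤-trans v≤y y≤s′)

popped<popper : ∀ {P t S x} → StackInvariant P (t ∷ S) → x ∉ P → t ≤ x → All (_< x) (t ∷ S)
popped<popper {x = x} I x∉P t≤x = All.tabulate below
  where
  below : ∀ {u} → u ∈ _ → u < x
  below {u} u∈S with <-cmp u x
  ... | tri< u<x _ _ = u<x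
  ... | tri≈ _ refl _ = ⊥-elim (x∉P (stack⊆read I u∈S))
  ... | tri> _ _ x<u = ⊥-elim (x∉P (stack⊆read I (consecutive-interval (consecutive I) u∈S t≤x (<⇒≤ x<u))))

invariant-start : ∀ {P x} → StackInvariant P [] → StackInvariant (P ++ [ x ]) (x ∷ [])
invariant-start {[]} {x} I = record
  { stack⊆read = λ { (here refl) → here refl }
  ; consecutive = [-]
  ; read≤stack = λ { (here refl) → x , here refl , ≤-refl }
  ; later<stack = λ { (here refl) (_ ∷ʳ ()) ; (here refl) (refl ∷ ()) }
  ; bypassed<top = λ { refl → [] , [] , refl , [] }
  }
invariant-start {_ ∷ _} I with read≤stack I (here refl)
... | _ , () , _

invariant-push : ∀ {P S x} → StackInvariant P (suc x ∷ S) → x ∉ P →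
                 StackInvariant (P ++ [ x ]) (x ∷ suc x ∷ S)
invariant-push {P} {S} {x} I x∉P = record
  { stack⊆read = λ { (here refl) → ∈-++⁺ʳ P (here refl) ; (there m) → ∈-++⁺ˡ (stack⊆read I m) }
  ; consecutive = refl ∷ consecutive I
  ; read≤stack = read≤
  ; later<stack = later<
  ; bypassed<top = λ { refl → P , [] , refl , [] }
  }
  where
  read≤ : ∀ {y} → y ∈ P ++ [ x ] → ∃ λ s → s ∈ x ∷ suc x ∷ S × y ≤ s
  read≤ p with ∈-++⁻ P p
  ... | inj₁ y∈P with read≤stack I y∈P
  ...   | s , s∈S , y≤s = s , there s∈S , y≤s
  read≤ p | inj₂ (here refl) = x , here refl , ≤-refl
  later< : ∀ {s y} → s ∈ x ∷ suc x ∷ S → s ∷ y ∷ [] ⊆ P ++ [ x ] → y < s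
  later< s∈ sy with s∈ | ⊆-∷ʳ-split P sy
  ... | here refl | inj₁ sy′ = ⊥-elim (x∉P (Any-resp-⊆ sy′ (here refl)))
  ... | here refl | inj₂ (_ , x∈P) = ⊥-elim (x∉P x∈P)
  ... | there s∈S | inj₁ sy′ = later<stack I s∈S sy′
  ... | there s∈S | inj₂ (refl , _) = top≤stack (consecutive I) s∈S

invariant-bypass : ∀ {P t S x} → StackInvariant P (t ∷ S) → suc x < t →
                   StackInvariant (P ++ [ x ]) (t ∷ S)
invariant-bypass {P} {t} {S} {x} I x+1<t = record
  { stack⊆read = ∈-++⁺ˡ ∘ stack⊆read I
  ; consecutive = consecutive I
  ; read≤stack = read≤
  ; later<stack = later<
  ; bypassed<top = bypassed<
  }
  where
  x<t : x < t
  x<t = <-trans (n<1+n x) x+1<t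
  read≤ : ∀ {y} → y ∈ P ++ [ x ] → ∃ λ s → s ∈ t ∷ S × y ≤ s
  read≤ p with ∈-++⁻ P p
  ... | inj₁ y∈P = read≤stack I y∈P
  ... | inj₂ (here refl) = t , here refl , <⇒≤ x<t
  later< : ∀ {s y} → s ∈ t ∷ S → s ∷ y ∷ [] ⊆ P ++ [ x ] → y < s
  later< s∈S sy with ⊆-∷ʳ-split P sy
  ... | inj₁ sy′ = later<stack I s∈S sy′
  ... | inj₂ (refl , _) = <-≤-trans x<t (top≤stack (consecutive I) s∈S)
  bypassed< : ∀ {t′ S′} → t ∷ S ≡ t′ ∷ S′ →
              ∃₂ λ P₁ M → P ++ [ x ] ≡ P₁ ++ t′ ∷ M × All (λ m → suc m < t′) M
  bypassed< refl with bypassed<top I refl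
  ... | P₁ , M , refl , M<t = P₁ , M ++ [ x ] , ++-assoc P₁ (t ∷ M) [ x ] , All-++⁺ M<t (x+1<t ∷ [])

invariant-pop : ∀ {P t S x} → StackInvariant P (t ∷ S) → x ∉ P → t ≤ x →
                StackInvariant (P ++ [ x ]) (x ∷ [])
invariant-pop {P} {t} {S} {x} I x∉P t≤x = record
  { stack⊆read = λ { (here refl) → ∈-++⁺ʳ P (here refl) }
  ; consecutive = [-]
  ; read≤stack = read≤
  ; later<stack = later<
  ; bypassed<top = λ { refl → P , [] , refl , [] }
  }
  where
  read≤ : ∀ {y} → y ∈ P ++ [ x ] → ∃ λ s → s ∈ x ∷ [] × y ≤ s
  read≤ p with ∈-++⁻ P p
  ... | inj₂ (here refl) = x , here refl , ≤-refl
  ... | inj₁ y∈P with read≤stack I y∈P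
  ...   | s , s∈S , y≤s = x , here refl , <⇒≤ (≤-<-trans y≤s (All.lookup (popped<popper I x∉P t≤x) s∈S))
  later< : ∀ {s y} → s ∈ x ∷ [] → s ∷ y ∷ [] ⊆ P ++ [ x ] → y < s
  later< (here refl) sy with ⊆-∷ʳ-split P sy
  ... | inj₁ sy′ = ⊥-elim (x∉P (Any-resp-⊆ sy′ (here refl)))
  ... | inj₂ (_ , x∈P) = ⊥-elim (x∉P x∈P)

invariant-step : ∀ {P S x} → StackInvariant P S → x ∉ P →
                 StackInvariant (P ++ [ x ]) (proj₂ (psb-step S x))
invariant-step {S = S} {x} I x∉P with psb-step S x | psb-step-view S x
... | _ | start = invariant-start I
... | _ | push refl = invariant-push I x∉P
... | _ | bypass x+1<t = invariant-bypass I x+1<t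
... | _ | pop t≤x = invariant-pop I x∉P t≤x

invariant-stackAfter : ∀ {P S} xs → StackInvariant P S → Unique (P ++ xs) →
                       StackInvariant (P ++ xs) (stackAfter S xs)
invariant-stackAfter {P} [] I _ = subst (λ P′ → StackInvariant P′ _) (sym (++-identityʳ P)) I
invariant-stackAfter {P} (x ∷ xs) I u =
  subst (λ P′ → StackInvariant P′ _) (++-assoc P [ x ] xs)
    (invariant-stackAfter xs (invariant-step I (Unique-middle u)) (subst Unique (sym (++-assoc P [ x ] xs)) u))

stack-invariant : ∀ {A} → Unique A → StackInvariant A (stack A)
stack-invariant {A} = invariant-stackAfter A (record
  { stack⊆read = λ () ; consecutive = [] ; read≤stack = λ () ; later<stack = λ () ; bypassed<top = λ () })

∈-psb⁻ : ∀ {π v} → v ∈ psb π → v ∈ π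
∈-psb⁻ {π} = ∈-resp-↭ (psb-go-↭ [] π)

∈-psb-go⁺ : ∀ S xs {v} → v ∈ S ++ xs → v ∈ psb-go S xs
∈-psb-go⁺ S xs = ∈-resp-↭ (↭-sym (psb-go-↭ S xs))

Unique-psb : ∀ {π} → Unique π → Unique (psb π)
Unique-psb {π} = Unique-resp-↭ (↭-sym (psb-go-↭ [] π))

⊆-psb-after : ∀ A {xs ys} → xs ⊆ psb-go (stack A) ys → xs ⊆ psb (A ++ ys)
⊆-psb-after A {ys = ys} s = subst (_ ⊆_) (sym (psb-go-++ [] A ys)) (Sublist.++⁺ˡ (emitted [] A) s)

unstacked-before-next : ∀ A {v C u} → u ∈ A → u ∉ stack A → u ∷ v ∷ [] ⊆ psb (A ++ v ∷ C)
unstacked-before-next A {v} {C} u∈A u∉S with read-emitted-or-stacked u∈A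
... | inj₂ u∈S = ⊥-elim (u∉S u∈S)
... | inj₁ u∈E = subst (_ ⊆_) (sym (psb-go-++ [] A (v ∷ C)))
                   (pair-⊆ u∈E (∈-psb-go⁺ (stack A) (v ∷ C) (∈-++⁺ʳ (stack A) (here refl))))

stacked-before-larger : ∀ {S C u v} → Consecutive S → u ∈ S → u < v → u ∷ v ∷ [] ⊆ psb-go S (v ∷ C)
stacked-before-larger {S} {C} {u} {v} c u∈S u<v rewrite psb-go-∷ S v C
  with psb-step S v | psb-step-view S v
... | _ | start = ⊥-elim (∉[] u∈S)
... | _ | push refl = ⊥-elim (<⇒≱ u<v (<⇒≤ (top≤stack c u∈S)))
... | _ | bypass v+1<t = ⊥-elim (<⇒≱ u<v (<⇒≤ (<-≤-trans (<-trans (n<1+n v) v+1<t) (top≤stack c u∈S))))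
... | _ | pop _ = pair-⊆ u∈S (∈-psb-go⁺ (v ∷ []) C (here refl))

smaller-before-stacked : ∀ {P S C u v} → StackInvariant P S → v ∉ P → u ∈ S → v < u →
                         v ∷ u ∷ [] ⊆ psb-go S (v ∷ C)
smaller-before-stacked {P} {S} {C} {u} {v} I v∉P u∈S v<u rewrite psb-go-∷ S v C
  with psb-step S v | psb-step-view S v
... | _ | start = ⊥-elim (∉[] u∈S)
... | _ | push _ = ⊆-trans (refl ∷ from∈ u∈S) (stack⊆psb-go (v ∷ S) C)
... | _ | bypass _ = refl ∷ ⊆-trans (from∈ u∈S) (stack⊆psb-go S C)
... | _ | pop t≤v =
  ⊥-elim (v∉P (stack⊆read I (consecutive-interval (consecutive I) u∈S t≤v (<⇒≤ v<u))))

read-before-larger : ∀ A {v C u} → Unique A → u ∈ A → u < v → u ∷ v ∷ [] ⊆ psb (A ++ v ∷ C)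
read-before-larger A {u = u} A! u∈A u<v with u ∈? stack A
... | no u∉S = unstacked-before-next A u∈A u∉S
... | yes u∈S = ⊆-psb-after A (stacked-before-larger (consecutive (stack-invariant A!)) u∈S u<v)

psb-descent : ∀ {π c b} → Unique π → c ∷ b ∷ [] ⊆ psb π → b < c →
              ∃₂ λ A C → π ≡ A ++ b ∷ C × c ∈ A × c ∉ stack A
psb-descent {π} π! cb b<c with ∈-∃++ (∈-psb⁻ {π} (Any-resp-⊆ cb (there (here refl))))
... | A , C , refl with ∈-++⁻ A (∈-psb⁻ {A ++ _ ∷ C} (Any-resp-⊆ cb (here refl)))
... | inj₂ (here refl) = ⊥-elim (<-irrefl refl b<c)
... | inj₂ (there c∈C) with ∈-∃++ c∈C
...   | C₁ , C₂ , refl = ⊥-elim (precedes-asym (Unique-psb π!) cb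
          (subst (λ τ → _ ∷ _ ∷ [] ⊆ psb τ) (++-assoc A (_ ∷ C₁) (_ ∷ C₂))
            (read-before-larger (A ++ _ ∷ C₁) (AllPairs-++⁻ˡ (subst Unique (sym (++-assoc A _ _)) π!))
              (∈-++⁺ʳ A (here refl)) b<c)))
psb-descent {π} π! cb b<c | A , C , refl | inj₁ c∈A with _ ∈? stack A
... | no c∉S = A , C , refl , c∈A , c∉S
... | yes c∈S = ⊥-elim (precedes-asym (Unique-psb π!) cb
                  (⊆-psb-after A (smaller-before-stacked (stack-invariant (AllPairs-++⁻ˡ π!))
                    (Unique-middle π!) c∈S b<c)))

leaves-stack⇒larger-later : ∀ {P S u} xs → StackInvariant P S → Unique (P ++ xs) →
                            u ∈ S → u ∉ stackAfter S xs → ∃ λ z → z ∈ xs × u < z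
leaves-stack⇒larger-later [] _ _ u∈S u∉ = ⊥-elim (u∉ u∈S)
leaves-stack⇒larger-later {P} {S} {u} (x ∷ xs) I P! u∈S u∉ with u ∈? proj₂ (psb-step S x)
... | yes u∈S′ with leaves-stack⇒larger-later xs (invariant-step I (Unique-middle P!))
                      (subst Unique (sym (++-assoc P [ x ] xs)) P!) u∈S′ u∉
...   | z , z∈xs , u<z = z , there z∈xs , u<z
leaves-stack⇒larger-later {P} {S} {u} (x ∷ xs) I P! u∈S u∉ | no u∉S′
  with psb-step S x | psb-step-view S x
... | _ | start = ⊥-elim (∉[] u∈S)
... | _ | push _ = ⊥-elim (u∉S′ (there u∈S))
... | _ | bypass _ = ⊥-elim (u∉S′ u∈S)
... | _ | pop t≤x = x , here refl , All.lookup (popped<popper I (Unique-middle P!) t≤x) u∈S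

-- Either c was popped by a larger entry of D, or it was bypassed under the top T, like
-- everything read since T.
unstacked-fate : ∀ {P S} c D → StackInvariant P S → Unique (P ++ c ∷ D) → c ∉ stackAfter S (c ∷ D) →
                 (∃ λ z → z ∈ D × c < z) ⊎
                 (∃₂ λ P₁ M → ∃ λ T → P ≡ P₁ ++ T ∷ M × All (λ m → suc m < T) M × suc c < T)
unstacked-fate {P} {S} c D I P! c∉ with c ∈? proj₂ (psb-step S c)
... | yes c∈S′ = inj₁ (leaves-stack⇒larger-later D (invariant-step I (Unique-middle P!))
                        (subst Unique (sym (++-assoc P [ c ] D)) P!) c∈S′ c∉)
... | no c∉S′ with psb-step S c | psb-step-view S c
...   | _ | start = ⊥-elim (c∉S′ (here refl))
...   | _ | push _ = ⊥-elim (c∉S′ (here refl))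
...   | _ | pop _ = ⊥-elim (c∉S′ (here refl))
...   | _ | bypass c+1<T with bypassed<top I refl
...     | P₁ , M , P≡ , M<T = inj₂ (P₁ , M , _ , P≡ , M<T , c+1<T)

-- The 321s of psb π

-- Occurrences of 3421, 53241 and 53214, with entries named by their values a < b < c < d < e.
data Forbidden (π : List ℕ) : Set where
  occ3421  : ∀ {a b c d} → c ∷ d ∷ b ∷ a ∷ [] ⊆ π → a < b → b < c → c < d → Forbidden π
  occ53241 : ∀ {a b c d e} → e ∷ c ∷ b ∷ d ∷ a ∷ [] ⊆ π → a < b → b < c → c < d → d < e → Forbidden π
  occ53214 : ∀ {a b c d e} → e ∷ c ∷ b ∷ a ∷ d ∷ [] ⊆ π → a < b → b < c → c < d → d < e → Forbidden π

DownClosed : List ℕ → Set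
DownClosed π = ∀ {w} → suc w ∈ π → 0 < w → w ∈ π

bypassed-321⇒forbidden :
  ∀ A₁ T M c D b C₁ a C₂ → DownClosed (((A₁ ++ T ∷ M) ++ c ∷ D) ++ b ∷ C₁ ++ a ∷ C₂) →
  All (λ m → suc m < T) M → suc c < T → a < b → b < c →
  Forbidden (((A₁ ++ T ∷ M) ++ c ∷ D) ++ b ∷ C₁ ++ a ∷ C₂)
bypassed-321⇒forbidden A₁ (suc w) M c D b C₁ a C₂ down M<T (s≤s c<w) a<b b<c =
  locate (down (∈-++⁺ˡ (∈-++⁺ˡ T∈)) (≤-<-trans z≤n c<w))
  where
  T∈ : suc w ∈ A₁ ++ suc w ∷ M
  T∈ = ∈-++⁺ʳ A₁ (here refl)
  b<w : b < w
  b<w = <-trans b<c c<w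
  ba : b ∷ a ∷ [] ⊆ b ∷ C₁ ++ a ∷ C₂
  ba = refl ∷ from∈ (∈-++⁺ʳ C₁ (here refl))
  Tc : suc w ∷ c ∷ [] ⊆ (A₁ ++ suc w ∷ M) ++ c ∷ D
  Tc = ∈-++-⊆ T∈ (refl ∷ minimum D)
  locate : w ∈ ((A₁ ++ suc w ∷ M) ++ c ∷ D) ++ b ∷ C₁ ++ a ∷ C₂ →
           Forbidden (((A₁ ++ suc w ∷ M) ++ c ∷ D) ++ b ∷ C₁ ++ a ∷ C₂)
  locate p with ∈-++⁻ _ p
  ... | inj₁ p₁ with ∈-++⁻ _ p₁
  ...   | inj₁ p₂ with ∈-++⁻ A₁ p₂
  ...     | inj₁ w∈A₁ = occ3421 (Sublist.++⁺ (Sublist.++⁺ʳ (c ∷ D) (∈-++-⊆ w∈A₁ (refl ∷ minimum M))) ba)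
                          a<b b<w (n<1+n w)
  ...     | inj₂ (here w≡T) = ⊥-elim (<-irrefl w≡T (n<1+n w))
  ...     | inj₂ (there w∈M) = ⊥-elim (<-irrefl refl (All.lookup M<T w∈M))
  locate p | inj₁ p₁ | inj₂ (here w≡c) = ⊥-elim (<-irrefl (sym w≡c) c<w)
  locate p | inj₁ p₁ | inj₂ (there w∈D) =
    occ3421 (Sublist.++⁺ (Sublist.++⁺ˡ (A₁ ++ suc w ∷ M) (refl ∷ from∈ w∈D)) ba) a<b b<c c<w
  locate p | inj₂ (here w≡b) = ⊥-elim (<-irrefl (sym w≡b) b<w)
  locate p | inj₂ (there p₁) with ∈-++⁻ C₁ p₁
  ... | inj₁ w∈C₁ = occ53241 (Sublist.++⁺ Tc (refl ∷ ∈-++-⊆ w∈C₁ (refl ∷ minimum C₂))) a<b b<c c<w (n<1+n w)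
  ... | inj₂ (here w≡a) = ⊥-elim (<-irrefl (sym w≡a) (<-trans a<b b<w))
  ... | inj₂ (there w∈C₂) =
    occ53214 (Sublist.++⁺ Tc (refl ∷ Sublist.++⁺ˡ C₁ (refl ∷ from∈ w∈C₂))) a<b b<c c<w (n<1+n w)

psb-321⇒forbidden : ∀ {π} → Unique π → DownClosed π → Has321 (psb π) → Forbidden π
psb-321⇒forbidden {π} π! down (has321 {c} {b} {a} s b<c a<b)
  with psb-descent π! (⊆-trans (refl ∷ refl ∷ a ∷ʳ []) s) b<c
     | psb-descent π! (⊆-trans (c ∷ʳ refl ∷ refl ∷ []) s) a<b
... | A , C , refl , c∈A , c∉S | A′ , C′ , π≡ , b∈A′ , _ with ∈-∃++ c∈A
... | A₀ , D , refl with ∈-∃++ (follows-suffix (A₀ ++ c ∷ D) π! (subst (b ∷ a ∷ [] ⊆_) (sym π≡) (pair-⊆ b∈A′ (here refl))))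
... | C₁ , C₂ , refl
  with unstacked-fate {A₀} c D (stack-invariant (AllPairs-++⁻ˡ (AllPairs-++⁻ˡ π!))) (AllPairs-++⁻ˡ π!)
         (subst (c ∉_) (stackAfter-++ [] A₀ (c ∷ D)) c∉S)
... | inj₁ (z , z∈D , c<z) =
  occ3421 (Sublist.++⁺ (Sublist.++⁺ˡ A₀ (refl ∷ from∈ z∈D)) (refl ∷ from∈ (∈-++⁺ʳ C₁ (here refl)))) a<b b<c c<z
... | inj₂ (A₁ , M , T , refl , M<T , c+1<T) = bypassed-321⇒forbidden A₁ T M c D b C₁ a C₂ down M<T c+1<T a<b b<c

larger-later⇒unstacked : ∀ {A u z} → Unique A → u ∷ z ∷ [] ⊆ A → u < z → u ∉ stack A
larger-later⇒unstacked A! uz u<z u∈S = <-asym u<z (later<stack (stack-invariant A!) u∈S uz)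

gap⇒unstacked : ∀ {π} A {v C u d e} → Unique π → π ≡ A ++ v ∷ C → e ∈ A → d ∈ v ∷ C →
                u ≤ d → d ≤ e → u ∉ stack A
gap⇒unstacked A π! refl e∈A d∈ u≤d d≤e u∈S =
  Unique-++-disjoint π! (stack⊆read I (stack-interval I u∈S u≤d e∈A d≤e)) d∈
  where
  I : StackInvariant A (stack A)
  I = stack-invariant (AllPairs-++⁻ˡ π!)

unstacked⇒psb-321 : ∀ {π} A A′ {C C′ a b c} → Unique π → π ≡ A ++ b ∷ C → π ≡ A′ ++ a ∷ C′ →
                    c ∈ A → c ∉ stack A → b ∈ A′ → b ∉ stack A′ → b < c → a < b → Has321 (psb π)
unstacked⇒psb-321 A A′ π! π≡ π≡′ c∈A c∉S b∈A′ b∉S′ b<c a<b =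
  has321 (precedes-trans (Unique-psb π!) (before π≡ (unstacked-before-next A c∈A c∉S))
                                          (before π≡′ (unstacked-before-next A′ b∈A′ b∉S′))) b<c a<b
  where
  before : ∀ {π π′ u v} → π ≡ π′ → u ∷ v ∷ [] ⊆ psb π′ → u ∷ v ∷ [] ⊆ psb π
  before refl uv = uv

forbidden⇒psb-321 : ∀ {π} → Unique π → Forbidden π → Has321 (psb π)
forbidden⇒psb-321 π! (occ3421 {a} {b} {c} {d} s a<b b<c c<d)
  with ⊆-split-at (c ∷ d ∷ []) b (a ∷ []) s | ⊆-split-at (c ∷ d ∷ b ∷ []) a [] s
... | A , _ , π≡ , cd⊆A , _ | A′ , _ , π≡′ , cdb⊆A′ , _ =
  unstacked⇒psb-321 A A′ π! π≡ π≡′ (Any-resp-⊆ cd⊆A (here refl)) c∉S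
    (Any-resp-⊆ cdb⊆A′ (there (there (here refl)))) b∉S′ b<c a<b
  where
  c∉S : c ∉ stack A
  c∉S = larger-later⇒unstacked (Unique-prefix π≡ π!) cd⊆A c<d
  b∉S′ : b ∉ stack A′
  b∉S′ b∈S′ = larger-later⇒unstacked A′! (⊆-trans (refl ∷ refl ∷ b ∷ʳ []) cdb⊆A′) c<d
    (stack-interval (stack-invariant A′!) b∈S′ (<⇒≤ b<c) (Any-resp-⊆ cdb⊆A′ (there (here refl))) (<⇒≤ c<d))
    where
    A′! : Unique A′
    A′! = Unique-prefix π≡′ π!
forbidden⇒psb-321 π! (occ53241 {a} {b} {c} {d} {e} s a<b b<c c<d d<e)
  with ⊆-split-at (e ∷ c ∷ []) b (d ∷ a ∷ []) s | ⊆-split-at (e ∷ c ∷ b ∷ d ∷ []) a [] s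
... | A , _ , π≡ , ec⊆A , da⊆C | A′ , _ , π≡′ , ecbd⊆A′ , _ =
  unstacked⇒psb-321 A A′ π! π≡ π≡′ (Any-resp-⊆ ec⊆A (there (here refl))) c∉S
    (Any-resp-⊆ ecbd⊆A′ (there (there (here refl)))) b∉S′ b<c a<b
  where
  c∉S : c ∉ stack A
  c∉S = gap⇒unstacked A π! π≡ (Any-resp-⊆ ec⊆A (here refl)) (there (Any-resp-⊆ da⊆C (here refl)))
          (<⇒≤ c<d) (<⇒≤ d<e)
  b∉S′ : b ∉ stack A′
  b∉S′ = larger-later⇒unstacked (Unique-prefix π≡′ π!) (⊆-trans (e ∷ʳ c ∷ʳ refl ∷ refl ∷ []) ecbd⊆A′)
           (<-trans b<c c<d)
forbidden⇒psb-321 π! (occ53214 {a} {b} {c} {d} {e} s a<b b<c c<d d<e)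
  with ⊆-split-at (e ∷ c ∷ []) b (a ∷ d ∷ []) s | ⊆-split-at (e ∷ c ∷ b ∷ []) a (d ∷ []) s
... | A , _ , π≡ , ec⊆A , ad⊆C | A′ , _ , π≡′ , ecb⊆A′ , d⊆C′ =
  unstacked⇒psb-321 A A′ π! π≡ π≡′ (Any-resp-⊆ ec⊆A (there (here refl))) c∉S
    (Any-resp-⊆ ecb⊆A′ (there (there (here refl)))) b∉S′ b<c a<b
  where
  c∉S : c ∉ stack A
  c∉S = gap⇒unstacked A π! π≡ (Any-resp-⊆ ec⊆A (here refl)) (there (Any-resp-⊆ ad⊆C (there (here refl))))
          (<⇒≤ c<d) (<⇒≤ d<e)
  b∉S′ : b ∉ stack A′
  b∉S′ = gap⇒unstacked A′ π! π≡′ (Any-resp-⊆ ecb⊆A′ (here refl)) (there (Any-resp-⊆ d⊆C′ (here refl)))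
           (<⇒≤ (<-trans b<c c<d)) (<⇒≤ d<e)

psb-321⇔forbidden : ∀ {π} → Unique π → DownClosed π → Has321 (psb π) ⇔ Forbidden π
psb-321⇔forbidden π! down = mk⇔ (psb-321⇒forbidden π! down) (forbidden⇒psb-321 π!)

-- Order isomorphisms

-- vs ! i is the i-th entry of vs, counting from 1; out-of-range indices give 0.
_!_ : List ℕ → ℕ → ℕ
(v ∷ _) ! 1 = v
(_ ∷ vs) ! suc (suc i) = vs ! suc i
_ ! _ = 0

!-∈ : ∀ vs {i} → 1 ≤ i → i ≤ length vs → vs ! i ∈ vs
!-∈ (v ∷ vs) {1} _ _ = here refl
!-∈ (v ∷ vs) {suc (suc i)} _ (s≤s i<) = there (!-∈ vs (s≤s z≤n) i<)

!-mono : ∀ {vs i j} → Increasing vs → 1 ≤ i → i < j → j ≤ length vs → vs ! i < vs ! j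
!-mono {v ∷ vs} {1} {suc (suc j)} (v<vs ∷ _) _ _ (s≤s j≤) = All.lookup v<vs (!-∈ vs (s≤s z≤n) j≤)
!-mono {v ∷ vs} {suc (suc i)} {suc (suc j)} (_ ∷ vs↑) _ (s≤s i<j) (s≤s j≤) = !-mono vs↑ (s≤s z≤n) i<j j≤
!-mono {i = 1} {1} _ _ (s≤s ()) _

lookup-map : ∀ (f : ℕ → ℕ) p i → lookup (map f p) i ≡ f (lookup p (cast (length-map f p) i))
lookup-map f (x ∷ p) zero = refl
lookup-map f (x ∷ p) (suc i) = lookup-map f p i

OrderIso-map : ∀ (f : ℕ → ℕ) p → (∀ {x y} → x ∈ p → y ∈ p → x < y → f x < f y) → OrderIso (map f p) p
OrderIso-map f p mono = length-map f p , λ i j →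
  subst₂ (λ u v → (u < v) ⇔ (lookup p (cast _ i) < lookup p (cast _ j)))
    (sym (lookup-map f p i)) (sym (lookup-map f p j))
    (mono⇔ (∈-lookup _) (∈-lookup _))
  where
  mono⇔ : ∀ {x y} → x ∈ p → y ∈ p → (f x < f y) ⇔ (x < y)
  mono⇔ {x} {y} x∈p y∈p = mk⇔ reflect (mono x∈p y∈p)
    where
    reflect : f x < f y → x < y
    reflect fx<fy with <-cmp x y
    ... | tri< x<y _ _ = x<y
    ... | tri≈ _ refl _ = ⊥-elim (<-irrefl refl fx<fy)
    ... | tri> _ _ y<x = ⊥-elim (<-asym fx<fy (mono y∈p x∈p y<x))

-- An increasing list vs of values realises p by sending the rank r to vs ! r.
contains-ranks : ∀ {π} vs p → Linked _<_ vs → All (λ r → 1 ≤ r × r ≤ length vs) p →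
                 map (vs !_) p ⊆ π → Contains π p
contains-ranks vs p vs↑ p∈ s = map (vs !_) p , s , OrderIso-map (vs !_) p mono
  where
  mono : ∀ {x y} → x ∈ p → y ∈ p → x < y → vs ! x < vs ! y
  mono x∈p y∈p x<y = !-mono (Linked⇒AllPairs <-trans vs↑) (proj₁ (All.lookup p∈ x∈p)) x<y (proj₂ (All.lookup p∈ y∈p))

OrderIso⇒< : ∀ {σ p} (iso : OrderIso σ p) i j →
             lookup p (cast (proj₁ iso) i) < lookup p (cast (proj₁ iso) j) → lookup σ i < lookup σ j
OrderIso⇒< (_ , iso) i j = Equivalence.from (iso i j)

contains3421⇒forbidden : ∀ {π} → Contains π (3 ∷ 4 ∷ 2 ∷ 1 ∷ []) → Forbidden π
contains3421⇒forbidden (_ ∷ _ ∷ _ ∷ _ ∷ [] , s , iso@(refl , _)) =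
  occ3421 s (OrderIso⇒< iso (# 3) (# 2) (n<1+n 1)) (OrderIso⇒< iso (# 2) (# 0) (n<1+n 2))
    (OrderIso⇒< iso (# 0) (# 1) (n<1+n 3))
contains3421⇒forbidden ([] , _ , () , _)
contains3421⇒forbidden (_ ∷ [] , _ , () , _)
contains3421⇒forbidden (_ ∷ _ ∷ [] , _ , () , _)
contains3421⇒forbidden (_ ∷ _ ∷ _ ∷ [] , _ , () , _)
contains3421⇒forbidden (_ ∷ _ ∷ _ ∷ _ ∷ _ ∷ _ , _ , () , _)

contains53241⇒forbidden : ∀ {π} → Contains π (5 ∷ 3 ∷ 2 ∷ 4 ∷ 1 ∷ []) → Forbidden π
contains53241⇒forbidden (_ ∷ _ ∷ _ ∷ _ ∷ _ ∷ [] , s , iso@(refl , _)) =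
  occ53241 s (OrderIso⇒< iso (# 4) (# 2) (n<1+n 1)) (OrderIso⇒< iso (# 2) (# 1) (n<1+n 2))
    (OrderIso⇒< iso (# 1) (# 3) (n<1+n 3)) (OrderIso⇒< iso (# 3) (# 0) (n<1+n 4))
contains53241⇒forbidden ([] , _ , () , _)
contains53241⇒forbidden (_ ∷ [] , _ , () , _)
contains53241⇒forbidden (_ ∷ _ ∷ [] , _ , () , _)
contains53241⇒forbidden (_ ∷ _ ∷ _ ∷ [] , _ , () , _)
contains53241⇒forbidden (_ ∷ _ ∷ _ ∷ _ ∷ [] , _ , () , _)
contains53241⇒forbidden (_ ∷ _ ∷ _ ∷ _ ∷ _ ∷ _ ∷ _ , _ , () , _)

contains53214⇒forbidden : ∀ {π} → Contains π (5 ∷ 3 ∷ 2 ∷ 1 ∷ 4 ∷ []) → Forbidden π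
contains53214⇒forbidden (_ ∷ _ ∷ _ ∷ _ ∷ _ ∷ [] , s , iso@(refl , _)) =
  occ53214 s (OrderIso⇒< iso (# 3) (# 2) (n<1+n 1)) (OrderIso⇒< iso (# 2) (# 1) (n<1+n 2))
    (OrderIso⇒< iso (# 1) (# 4) (n<1+n 3)) (OrderIso⇒< iso (# 4) (# 0) (n<1+n 4))
contains53214⇒forbidden ([] , _ , () , _)
contains53214⇒forbidden (_ ∷ [] , _ , () , _)
contains53214⇒forbidden (_ ∷ _ ∷ [] , _ , () , _)
contains53214⇒forbidden (_ ∷ _ ∷ _ ∷ [] , _ , () , _)
contains53214⇒forbidden (_ ∷ _ ∷ _ ∷ _ ∷ [] , _ , () , _)
contains53214⇒forbidden (_ ∷ _ ∷ _ ∷ _ ∷ _ ∷ _ ∷ _ , _ , () , _)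

ranks-within : ∀ {k p} → {True (All.all? (λ r → 1 ≤? r ×-dec r ≤? k) p)} → All (λ r → 1 ≤ r × r ≤ k) p
ranks-within {_} {_} {t} = toWitness t

avoids⇔¬forbidden : ∀ {π} →
  Av ((3 ∷ 4 ∷ 2 ∷ 1 ∷ []) ∷ (5 ∷ 3 ∷ 2 ∷ 4 ∷ 1 ∷ []) ∷ (5 ∷ 3 ∷ 2 ∷ 1 ∷ 4 ∷ []) ∷ []) π ⇔ (¬ Forbidden π)
avoids⇔¬forbidden = mk⇔ avoids⇒¬forbidden
  λ ¬f → (¬f ∘ contains3421⇒forbidden) ∷ (¬f ∘ contains53241⇒forbidden) ∷ (¬f ∘ contains53214⇒forbidden) ∷ []
  where
  avoids⇒¬forbidden : ∀ {π} → Av _ π → ¬ Forbidden π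
  avoids⇒¬forbidden (¬3421 ∷ _ ∷ _ ∷ []) (occ3421 {a} {b} {c} {d} s a<b b<c c<d) =
    ¬3421 (contains-ranks (a ∷ b ∷ c ∷ d ∷ []) _ (a<b ∷ b<c ∷ c<d ∷ [-]) ranks-within s)
  avoids⇒¬forbidden (_ ∷ ¬53241 ∷ _ ∷ []) (occ53241 {a} {b} {c} {d} {e} s a<b b<c c<d d<e) =
    ¬53241 (contains-ranks (a ∷ b ∷ c ∷ d ∷ e ∷ []) _ (a<b ∷ b<c ∷ c<d ∷ d<e ∷ [-]) ranks-within s)
  avoids⇒¬forbidden (_ ∷ _ ∷ ¬53214 ∷ []) (occ53214 {a} {b} {c} {d} {e} s a<b b<c c<d d<e) =
    ¬53214 (contains-ranks (a ∷ b ∷ c ∷ d ∷ e ∷ []) _ (a<b ∷ b<c ∷ c<d ∷ d<e ∷ [-]) ranks-within s)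

idPerm-increasing : ∀ n → Increasing (idPerm n)
idPerm-increasing n = AllPairs.map⁺ (AllPairs.applyUpTo⁺₁ (λ i → i) n λ i<j _ → s≤s i<j)

↭-idPerm⇒DownClosed : ∀ {n π} → π ↭ idPerm n → DownClosed π
↭-idPerm⇒DownClosed {n} π↭ {suc j} w+1∈π _ with ∈-map⁻ suc (∈-resp-↭ π↭ w+1∈π)
... | _ , i∈ , refl = ∈-resp-↭ (↭-sym π↭) (∈-map⁺ suc (∈-upTo⁺ (<-trans (n<1+n j) (∈-upTo⁻ i∈))))

mainTheorem17 : (n : ℕ) (π : List ℕ) → IsPerm n π →
    (que (psb π) ≡ idPerm n) ⇔
      Av ((3 ∷ 4 ∷ 2 ∷ 1 ∷ []) ∷ (5 ∷ 3 ∷ 2 ∷ 4 ∷ 1 ∷ []) ∷ (5 ∷ 3 ∷ 2 ∷ 1 ∷ 4 ∷ []) ∷ []) π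
mainTheorem17 n π π↭ = begin
  que (psb π) ≡ idPerm n    ∼⟨ ≡⇔Increasing que↭ (idPerm-increasing n) ⟩
  Increasing (que (psb π))  ∼⟨ que-sorts⇔¬321 (Unique-psb π!) ⟩
  ¬ Has321 (psb π)          ∼⟨ ¬-cong-⇔ (psb-321⇔forbidden π! (↭-idPerm⇒DownClosed π↭)) ⟩
  ¬ Forbidden π             ∼⟨ ⇔-sym avoids⇔¬forbidden ⟩
  Av _ π                    ∎
  where
  open EquationalReasoning
  π! : Unique π
  π! = Unique-resp-↭ (↭-sym π↭) (Increasing⇒Unique (idPerm-increasing n))
  que↭ : que (psb π) ↭ idPerm n
  que↭ = ↭-trans (que-go-↭ [] (psb π)) (↭-trans (psb-go-↭ [] π) π↭)
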